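{- Let $A=(a_1,\ldots,a_k)$ be positive integers with sum $n$, let $S\subseteq\{1,\ldots,k\}$, and let $\pi$ be an $(A,S)$-permutation of $\{1,\ldots,n\}$. For $x\in\{1,\ldots,n\}$ and $i\ge0$ let $w_i(x)$ be the index of the block containing $\pi^i(x)$, let $r_i(x)$ be the number of $j\in\{0,\ldots,i-1\}$ with $w_j(x)\in S$, and let $a_i(x)=(-1)^{r_i(x)}w_i(x)$. Let $\mathbf{A}(x)=(a_0(x),a_1(x),\ldots)$. If $v,v'\in\{1,\ldots,n\}$ satisfy $\mathbf{A}(v)<\mathbf{A}(v')$ in the lexicographic order, then $v<v'$.
   Context: Blocks: $A_i=\{a_1+\cdots+a_{i-1}+1,\ldots,a_1+\cdots+a_i\}$. An $(A,S)$-permutation is a permutation of $\{1,\ldots,n\}$ that is decreasing on each block $A_i$ with $i\in S$ and increasing on each block $A_i$ with $i\notin S$. -}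

module Defs where

open import Data.Nat using (ℕ; zero; suc)
open import Data.Fin as Fin using (Fin; zero; suc; toℕ; splitAt)
open import Data.Fin.Subset using (Subset; _∈_; _∉_)
open import Data.Fin.Permutation using (Permutation′; _⟨$⟩ʳ_)
open import Data.Vec using (Vec; []; _∷_; sum; lookup)
open import Data.Bool using (Bool; true; false; if_then_else_)
open import Data.Sum using (inj₁; inj₂)
open import Data.Product using (∃; _×_)
open import Data.Integer as ℤ using (ℤ; +_; -_)
open import Relation.Binary.PropositionalEquality using (_≡_)

-- Blocks are indexed 0-based by Fin k: block index i : Fin k is the paper's A_{i+1}.
-- Elements of {1,...,n} are represented 0-based by Fin n.
-- blockOf A x = the (0-based) index of the block of A containing x.
blockOf : ∀ {k} (A : Vec ℕ k) → Fin (sum A) → Fin k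
blockOf (a ∷ as) x with splitAt a x
... | inj₁ _ = zero
... | inj₂ y = suc (blockOf as y)

IsASPerm : ∀ {k} (A : Vec ℕ k) (S : Subset k) → Permutation′ (sum A) → Set
IsASPerm A S π =
  ∀ (x y : Fin (sum A)) → blockOf A x ≡ blockOf A y → x Fin.< y →
    (blockOf A x ∈ S → π ⟨$⟩ʳ y Fin.< π ⟨$⟩ʳ x) ×
    (blockOf A x ∉ S → π ⟨$⟩ʳ x Fin.< π ⟨$⟩ʳ y)

iter : ∀ {n} → Permutation′ n → ℕ → Fin n → Fin n
iter π zero x = x
iter π (suc i) x = π ⟨$⟩ʳ (iter π i x)

w : ∀ {k} (A : Vec ℕ k) → Permutation′ (sum A) → ℕ → Fin (sum A) → Fin k
w A π i x = blockOf A (iter π i x)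

r : ∀ {k} (A : Vec ℕ k) (S : Subset k) → Permutation′ (sum A) → ℕ → Fin (sum A) → ℕ
r A S π zero x = zero
r A S π (suc i) x =
  (if lookup S (w A π i x) then suc zero else zero) Data.Nat.+ r A S π i x

-- a_i(x) = (-1)^{r_i(x)} * w_i(x), with w_i(x) the paper's 1-based block index
aSeq : ∀ {k} (A : Vec ℕ k) (S : Subset k) → Permutation′ (sum A) → Fin (sum A) → ℕ → ℤ
aSeq A S π x i = ((- (+ 1)) ℤ.^ r A S π i x) ℤ.* (+ suc (toℕ (w A π i x)))

LexLt : (ℕ → ℤ) → (ℕ → ℤ) → Set
LexLt f g = ∃ λ m → (∀ j → j Data.Nat.< m → f j ≡ g j) × (f m ℤ.< g m)

-- Call two points x, y "in order at parity r" (Oriented _<_ r x y) if x < y for even r and y < x for odd r.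
-- Let m be the first index where the codes of v and v′ differ. Then r_m(v) = r_m(v′), so
-- a_m(v) < a_m(v′) says that the blocks of π^m(v), π^m(v′), and hence (blocks being
-- consecutive intervals) the points themselves, are in order at parity r_m(v). For j < m
-- the points π^j(v), π^j(v′) lie in the same block, on which π is increasing or decreasing;
-- π reverses order exactly when the block is in S, which is exactly when r_{j+1} = r_j + 1.
-- So being in order propagates from j + 1 down to j, and at j = 0 it says v < v′.
module Submission where

open import Defs
open import Data.Nat using (ℕ; _<_)
open import Data.Fin as Fin using (Fin)
open import Data.Fin.Subset using (Subset)
open import Data.Fin.Permutation using (Permutation′)
open import Data.Vec using (Vec; sum; lookup)

open import Level using (Level)
open import Data.Nat as ℕ using (zero; suc; _+_; _≤_)
import Data.Nat.Properties as ℕP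
open import Data.Fin using (toℕ; splitAt)
import Data.Fin.Properties as FP
open import Data.Fin.Subset using (_∈_; _∉_)
open import Data.Fin.Permutation using (_⟨$⟩ʳ_)
open import Data.Vec using (_∷_)
open import Data.Vec.Properties using (lookup⇒[]=; []=⇒lookup)
open import Data.Bool using (true; false; if_then_else_)
open import Data.Sum using (inj₁; inj₂)
open import Data.Product using (_,_; _×_; proj₁; proj₂; swap)
open import Data.Unit using (⊤; tt)
open import Data.Integer as ℤ using (+_; -_; -1ℤ)
import Data.Integer.Properties as ℤP
open import Data.Empty using (⊥-elim)
open import Function using (flip; _∘_)
open import Relation.Binary.Core using (Rel)
open import Relation.Binary.Definitions using (Symmetric; Irreflexive; Asymmetric; tri<; tri≈; tri>)
open import Relation.Binary.PropositionalEquality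

private
  variable
    a ℓ ℓ′ ℓ″ : Level
    A B : Set a

Oriented : Rel A ℓ → ℕ → Rel A ℓ
Oriented R zero    x y = R x y
Oriented R (suc r) x y = Oriented R r y x

Oriented-flip : ∀ {R : Rel A ℓ} r {x y} → Oriented R r y x → Oriented (flip R) r x y
Oriented-flip zero    o = o
Oriented-flip (suc r) o = Oriented-flip r o

Oriented-reflects : ∀ {R : Rel A ℓ} {R′ : Rel B ℓ′} {P : Rel B ℓ″} {f : B → A} →
                    Symmetric P → (∀ {x y} → P x y → R (f x) (f y) → R′ x y) →
                    ∀ r {x y} → P x y → Oriented R r (f x) (f y) → Oriented R′ r x y
Oriented-reflects P-sym reflect zero    p o = reflect p o
Oriented-reflects P-sym reflect (suc r) p o = Oriented-reflects P-sym reflect r (P-sym p) o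

backward-induction : ∀ (P : ℕ → Set ℓ) {m} → P m → (∀ j → j < m → P (suc j) → P j) → P 0
backward-induction P {zero}  pm step = pm
backward-induction P {suc m} pm step =
  backward-induction P (step m (ℕP.n<1+n m) pm) (λ j j<m → step j (ℕP.m<n⇒m<1+n j<m))

<-reflected : ∀ {n} (R : Rel (Fin n) ℓ) → Irreflexive _≡_ R → Asymmetric R →
              ∀ {x y} → (y Fin.< x → R y x) → R x y → x Fin.< y
<-reflected R irrefl asym {x} {y} monotone xRy with FP.<-cmp x y
... | tri< x<y _ _ = x<y
... | tri≈ _ x≡y _ = ⊥-elim (irrefl x≡y xRy)
... | tri> _ _ y<x = ⊥-elim (asym xRy (monotone y<x))

-1^suc*i≡-‿-1^*i : ∀ r i → -1ℤ ℤ.^ suc r ℤ.* i ≡ - (-1ℤ ℤ.^ r ℤ.* i)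
-1^suc*i≡-‿-1^*i r i = begin
  -1ℤ ℤ.* -1ℤ ℤ.^ r ℤ.* i     ≡⟨ ℤP.*-assoc -1ℤ (-1ℤ ℤ.^ r) i ⟩
  -1ℤ ℤ.* (-1ℤ ℤ.^ r ℤ.* i)   ≡⟨ ℤP.-1*i≡-i _ ⟩
  - (-1ℤ ℤ.^ r ℤ.* i)         ∎
  where open ≡-Reasoning

-1^*-injective : ∀ r {i j} → -1ℤ ℤ.^ r ℤ.* i ≡ -1ℤ ℤ.^ r ℤ.* j → i ≡ j
-1^*-injective zero    {i} {j} e = subst₂ _≡_ (ℤP.*-identityˡ i) (ℤP.*-identityˡ j) e
-1^*-injective (suc r) {i} {j} e = -1^*-injective r (ℤP.neg-injective
  (subst₂ _≡_ (-1^suc*i≡-‿-1^*i r i) (-1^suc*i≡-‿-1^*i r j) e))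

-1^*-reflects-< : ∀ r {i j} → -1ℤ ℤ.^ r ℤ.* i ℤ.< -1ℤ ℤ.^ r ℤ.* j → Oriented ℤ._<_ r i j
-1^*-reflects-< zero    {i} {j} lt = subst₂ ℤ._<_ (ℤP.*-identityˡ i) (ℤP.*-identityˡ j) lt
-1^*-reflects-< (suc r) {i} {j} lt = -1^*-reflects-< r (ℤP.neg-cancel-<
  (subst₂ ℤ._<_ (-1^suc*i≡-‿-1^*i r i) (-1^suc*i≡-‿-1^*i r j) lt))

splitAt≡inj₁⇒toℕ< : ∀ m {n} {i : Fin (m + n)} {j} → splitAt m i ≡ inj₁ j → toℕ i < m
splitAt≡inj₁⇒toℕ< m {n} {i} {j} eq =
  subst (_< m) (trans (sym (FP.toℕ-↑ˡ j n)) (cong toℕ (FP.splitAt⁻¹-↑ˡ eq))) (FP.toℕ<n j)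

splitAt≡inj₂⇒toℕ≡ : ∀ m {n} {i : Fin (m + n)} {j} → splitAt m i ≡ inj₂ j → toℕ i ≡ m + toℕ j
splitAt≡inj₂⇒toℕ≡ m {j = j} eq = trans (cong toℕ (sym (FP.splitAt⁻¹-↑ʳ eq))) (FP.toℕ-↑ʳ m j)

blockOf-reflects-< : ∀ {k} (A : Vec ℕ k) {x y} → blockOf A x Fin.< blockOf A y → x Fin.< y
blockOf-reflects-< (a ∷ as) {x} {y} lt with splitAt a x in ex | splitAt a y in ey
... | inj₁ _  | inj₁ _  with () ← lt
... | inj₂ _  | inj₁ _  with () ← lt
... | inj₁ _  | inj₂ y′ =
  ℕP.<-≤-trans (splitAt≡inj₁⇒toℕ< a ex)
               (subst (a ≤_) (sym (splitAt≡inj₂⇒toℕ≡ a ey)) (ℕP.m≤m+n a (toℕ y′)))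
... | inj₂ x′ | inj₂ y′ =
  subst₂ _<_ (sym (splitAt≡inj₂⇒toℕ≡ a ex)) (sym (splitAt≡inj₂⇒toℕ≡ a ey))
         (ℕP.+-monoʳ-< a (blockOf-reflects-< as (ℕ.s<s⁻¹ lt)))

lookup≡false⇒∉ : ∀ {n} {S : Subset n} {b} → lookup S b ≡ false → b ∉ S
lookup≡false⇒∉ S[b]≡false b∈S with () ← trans (sym S[b]≡false) ([]=⇒lookup b∈S)

module ASPermutation {k} (A : Vec ℕ k) (S : Subset k) (π : Permutation′ (sum A))
                     (isASPerm : IsASPerm A S π) where

  InBlock : Fin k → Rel (Fin (sum A)) _
  InBlock b x y = blockOf A x ≡ b × blockOf A y ≡ b

  ascending-reflects-< : ∀ {b x y} → b ∉ S → InBlock b x y →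
                         π ⟨$⟩ʳ x Fin.< π ⟨$⟩ʳ y → x Fin.< y
  ascending-reflects-< b∉S (x∈b , y∈b) =
    <-reflected (λ x y → π ⟨$⟩ʳ x Fin.< π ⟨$⟩ʳ y)
                (λ x≡y → FP.<-irrefl (cong (π ⟨$⟩ʳ_) x≡y)) FP.<-asym
                (λ y<x → proj₂ (isASPerm _ _ (trans y∈b (sym x∈b)) y<x)
                               (subst (_∉ S) (sym y∈b) b∉S))

  descending-reflects-< : ∀ {b x y} → b ∈ S → InBlock b x y →
                          π ⟨$⟩ʳ y Fin.< π ⟨$⟩ʳ x → x Fin.< y
  descending-reflects-< b∈S (x∈b , y∈b) =
    <-reflected (λ x y → π ⟨$⟩ʳ y Fin.< π ⟨$⟩ʳ x)
                (λ x≡y → FP.<-irrefl (cong (π ⟨$⟩ʳ_) (sym x≡y))) FP.<-asym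
                (λ y<x → proj₁ (isASPerm _ _ (trans y∈b (sym x∈b)) y<x)
                               (subst (_∈ S) (sym y∈b) b∈S))

  π-reflects-Oriented : ∀ r {x y} → blockOf A x ≡ blockOf A y →
    Oriented Fin._<_ ((if lookup S (blockOf A x) then 1 else 0) + r) (π ⟨$⟩ʳ x) (π ⟨$⟩ʳ y) →
    Oriented Fin._<_ r x y
  π-reflects-Oriented r {x} x~y o with lookup S (blockOf A x) in b∈?S
  ... | true  = Oriented-reflects swap (descending-reflects-< (lookup⇒[]= _ S b∈?S))
                                  r (refl , sym x~y) (Oriented-flip r o)
  ... | false = Oriented-reflects swap (ascending-reflects-< (lookup≡false⇒∉ b∈?S))
                                  r (refl , sym x~y) o

module Itineraries {k} (A : Vec ℕ k) (S : Subset k) (π : Permutation′ (sum A))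
                   (v v′ : Fin (sum A)) where

  w-agree : ∀ j → r A S π j v ≡ r A S π j v′ → aSeq A S π v j ≡ aSeq A S π v′ j →
            w A π j v ≡ w A π j v′
  w-agree j r≡ a≡ =
    FP.toℕ-injective (ℕP.suc-injective (ℤP.+-injective (-1^*-injective (r A S π j v)
      (subst (λ q → aSeq A S π v j ≡ -1ℤ ℤ.^ q ℤ.* + suc (toℕ (w A π j v′))) (sym r≡) a≡))))

  r-agree : ∀ {m} → (∀ j → j < m → aSeq A S π v j ≡ aSeq A S π v′ j) →
            ∀ j → j ≤ m → r A S π j v ≡ r A S π j v′
  r-agree agree zero    _   = refl
  r-agree agree (suc j) j<m =
    cong₂ (λ b t → (if lookup S b then 1 else 0) + t) (w-agree j r≡ (agree j j<m)) r≡
    where r≡ = r-agree agree j (ℕP.<⇒≤ j<m)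

  InOrderAt : ℕ → Set
  InOrderAt j = Oriented Fin._<_ (r A S π j v) (iter π j v) (iter π j v′)

  inOrder-at-first-difference : ∀ m → r A S π m v ≡ r A S π m v′ →
                                aSeq A S π v m ℤ.< aSeq A S π v′ m → InOrderAt m
  inOrder-at-first-difference m r≡ lt =
    Oriented-reflects {P = λ _ _ → ⊤} {f = λ x → + suc (toℕ (blockOf A x))} _
      (λ _ → blockOf-reflects-< A ∘ ℕ.s<s⁻¹ ∘ ℤP.drop‿+<+) (r A S π m v) tt
      (-1^*-reflects-< (r A S π m v)
        (subst (λ q → aSeq A S π v m ℤ.< -1ℤ ℤ.^ q ℤ.* + suc (toℕ (w A π m v′))) (sym r≡) lt))

corollary2p2 : ∀ {k} (A : Vec ℕ k) → (∀ i → 0 < lookup A i) →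
    (S : Subset k) (π : Permutation′ (sum A)) → IsASPerm A S π →
    (v v′ : Fin (sum A)) → LexLt (aSeq A S π v) (aSeq A S π v′) → v Fin.< v′
corollary2p2 A _ S π isASPerm v v′ (m , agree , lt) =
  backward-induction InOrderAt
    (inOrder-at-first-difference m (r-agree agree m ℕP.≤-refl) lt)
    (λ j j<m → π-reflects-Oriented (r A S π j v)
                 (w-agree j (r-agree agree j (ℕP.<⇒≤ j<m)) (agree j j<m)))
  where
  open ASPermutation A S π isASPerm
  open Itineraries A S π v v′
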